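{- Let $G$ be a $d$-regular, undirected, aperiodic multigraph on $n$ vertices with a two-way labeling and $H$ be a regular multigraph on $d$ vertices with a two-way labeling and with $\lambda(H)\leq \alpha$. Then \[ L(G^{2})\approx_{\epsilon} L(G\circledS H) \] for $\epsilon=\ln(1/(1-\alpha))$.
   Context: For a regular undirected multigraph $G$ with transition matrix $M$ (adjacency matrix divided by the degree), $L(G)=I-M$ is its normalized Laplacian, and $\lambda(G)=\max_{v\perp\vec{1},v\neq 0}\|Mv\|/\|v\|$ is the second largest absolute value of an eigenvalue of $M$. $G^2$ is the multigraph whose edges correspond to walks of length 2 in $G$ (transition matrix $M^2$). For symmetric matrices $X,Y$, $X\approx_\epsilon Y$ means $e^{ -\epsilon}X\preceq Y\preceq e^{\epsilon}X$ in the positive semidefinite order. A two-way labeling of a $d$-regular multigraph gives each edge a label in $[d]$ at each endpoint, with distinct labels at each vertex; its rotation map $\mathrm{Rot}_G:[n]\times[d]\to[n]\times[d]$ sends $(v,i)$ to $(w,j)$ if the $i$th edge at $v$ leads to $w$ and is the $j$th edge at $w$. For $H$ $c$-regular on $d$ vertices, the derandomized square $G\circledS H$ is the $(d\cdot c)$-regular multigraph on $n$ vertices with rotation map: on input $(v_0,(i_0,j_0))$, let $(v_1,i_1)=\mathrm{Rot}_G(v_0,i_0)$, $(i_2,j_1)=\mathrm{Rot}_H(i_1,j_0)$, $(v_2,i_3)=\mathrm{Rot}_G(v_1,i_2)$, and output $(v_2,(i_3,j_1))$.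
   Formalization: The parameter α is rational, and both the positive semidefinite order and the bound $\lambda(H)\leq \alpha$ are tested on vectors with rational entries. -}

module Defs where

open import Data.Nat as ℕ using (ℕ; zero; suc)
open import Data.Fin as Fin using (Fin)
open import Data.Product using (_×_; _,_; proj₁; proj₂; ∃)
open import Data.List using (List; []; _∷_; length)
open import Data.Integer using (+_)
open import Data.Rational using (ℚ; 0ℚ; 1ℚ; _+_; _*_; _-_; _≤_; _/_; 1/_; ≢-nonZero)
open import Data.Rational.Properties using (_≟_)
open import Relation.Binary.PropositionalEquality using (_≡_)
open import Relation.Nullary using (yes; no)

sumFin : (k : ℕ) → (Fin k → ℚ) → ℚ
sumFin zero    f = 0ℚ
sumFin (suc k) f = f Fin.zero + sumFin k (λ i → f (Fin.suc i))

Vector : ℕ → Set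
Vector n = Fin n → ℚ

Matrix : ℕ → Set
Matrix n = Fin n → Fin n → ℚ

δ : ∀ {n} → Fin n → Fin n → ℚ
δ v w with v Fin.≟ w
... | yes _ = 1ℚ
... | no  _ = 0ℚ

-- Reciprocal of a rational (totalised: recip 0 = 0; only used at nonzero values)
recip : ℚ → ℚ
recip p with p ≟ 0ℚ
... | yes _  = 0ℚ
... | no p≢0 = 1/_ p {{≢-nonZero p≢0}}

-- 1/k for a natural number k (totalised at 0; only used at k ≥ 1)
invℕ : ℕ → ℚ
invℕ zero    = 0ℚ
invℕ (suc k) = + 1 / suc k

idM : ∀ {n} → Matrix n
idM = δ

_-M_ : ∀ {n} → Matrix n → Matrix n → Matrix n
(A -M B) v w = A v w - B v w

_·M_ : ∀ {n} → ℚ → Matrix n → Matrix n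
(c ·M A) v w = c * A v w

_*M_ : ∀ {n} → Matrix n → Matrix n → Matrix n
_*M_ {n} A B v w = sumFin n (λ u → A v u * B u w)

_*V_ : ∀ {n} → Matrix n → Vector n → Vector n
_*V_ {n} A x v = sumFin n (λ w → A v w * x w)

dot : ∀ {n} → Vector n → Vector n → ℚ
dot {n} x y = sumFin n (λ v → x v * y v)

normSq : ∀ {n} → Vector n → ℚ
normSq x = dot x x

quad : ∀ {n} → Matrix n → Vector n → ℚ
quad A x = dot x (A *V x)

-- Loewner order X ⪯ Y  (Y - X positive semidefinite), tested on ℚ-vectors
_⪯_ : ∀ {n} → Matrix n → Matrix n → Set
_⪯_ {n} X Y = (x : Vector n) → quad X x ≤ quad Y x

-- X ≈_ε Y, with the scalar e^ε given explicitly as `eε`: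
--   e^{-ε} X ⪯ Y ⪯ e^{ε} X
Approx : ∀ {n} → (eε : ℚ) → Matrix n → Matrix n → Set
Approx eε X Y = ((recip eε ·M X) ⪯ Y) × (Y ⪯ (eε ·M X))

-- a d-regular multigraph on n vertices with a two-way labelling
RotMap : ℕ → ℕ → Set
RotMap n d = Fin n × Fin d → Fin n × Fin d

-- rotation maps of undirected graphs are involutions
IsRotMap : ∀ {n d} → RotMap n d → Set
IsRotMap rot = ∀ p → rot (rot p) ≡ p

nbr : ∀ {n d} → RotMap n d → Fin n → Fin d → Fin n
nbr rot v i = proj₁ (rot (v , i))

transM : ∀ {n d} → RotMap n d → Matrix n
transM {n} {d} rot v w = invℕ d * sumFin d (λ i → δ (nbr rot v i) w)

laplacian : ∀ {n d} → RotMap n d → Matrix n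
laplacian rot = idM -M transM rot

-- Laplacian of G², whose transition matrix is M²
laplacianSq : ∀ {n d} → RotMap n d → Matrix n
laplacianSq rot = idM -M (transM rot *M transM rot)

walkEnd : ∀ {n d} → RotMap n d → Fin n → List (Fin d) → Fin n
walkEnd rot v []       = v
walkEnd rot v (i ∷ ls) = walkEnd rot (nbr rot v i) ls

-- aperiodic: every vertex has period 1; for an undirected graph (closed
-- walks of length 2 always exist) this means every vertex lies on a
-- closed walk of odd length
Aperiodic : ∀ {n d} → RotMap n d → Set
Aperiodic {n} {d} rot =
  (v : Fin n) → ∃ λ (ls : List (Fin d)) →
    (∃ λ k → length ls ≡ suc (2 ℕ.* k)) × walkEnd rot v ls ≡ v

-- λ(H) ≤ α :  ‖M x‖ ≤ α ‖x‖ for all x ⊥ 1 (squared; α ≥ 0 assumed separately)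
LambdaLe : ∀ {n d} → RotMap n d → ℚ → Set
LambdaLe {n} rot α =
  (x : Vector n) → sumFin n x ≡ 0ℚ →
    normSq (transM rot *V x) ≤ (α * α) * normSq x

dsRot : ∀ {n d c} → RotMap n d → RotMap d c →
        Fin n × (Fin d × Fin c) → Fin n × (Fin d × Fin c)
dsRot rotG rotH (v₀ , (i₀ , j₀)) with rotG (v₀ , i₀)
... | (v₁ , i₁) with rotH (i₁ , j₀)
... | (i₂ , j₁) with rotG (v₁ , i₂)
... | (v₂ , i₃) = v₂ , (i₃ , j₁)

dsTransM : ∀ {n d c} → RotMap n d → RotMap d c → Matrix n
dsTransM {n} {d} {c} rotG rotH v w =
  invℕ (d ℕ.* c) *
    sumFin d (λ i → sumFin c (λ j → δ (proj₁ (dsRot rotG rotH (v , (i , j)))) w))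

dsLaplacian : ∀ {n d c} → RotMap n d → RotMap d c → Matrix n
dsLaplacian rotG rotH = idM -M dsTransM rotG rotH

{-# OPTIONS --safe #-}
-- For a vertex u of G let y_u = (x(v[u,i]))_{i ∈ [d]} be the values of x around u and
-- z_u = y_u − avg(y_u)·1 its centred part. Since Rot_G is an involution, a walk of G² or
-- of G Ⓢ H can be re-read from its middle vertex, and both forms split over local views:
--   xᵀ L(G²) x = (1/d) Σ_u ‖z_u‖²   and   xᵀ L(G Ⓢ H) x = (1/d) Σ_u z_uᵀ L(H) z_u,
-- the latter because the Laplacian form of the regular graph H ignores constant shifts.
-- As z_u ⊥ 1, λ(H) ≤ α gives |⟨z_u, M_H z_u⟩| ≤ α‖z_u‖², so
-- (1 − α)‖z_u‖² ≤ z_uᵀ L(H) z_u ≤ (1 + α)‖z_u‖² ≤ ‖z_u‖² / (1 − α), and we sum over u.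
-- Aperiodicity is needed only to rule out degree 0 on a nonempty vertex set.
module Submission where

open import Defs
open import Data.Nat using (ℕ)
open import Data.Rational using (ℚ; 0ℚ; 1ℚ; _-_; _≤_; _<_)
open import Data.Nat as ℕ using ()

open import Algebra.Bundles using (CommutativeRing)
open import Data.Empty using (⊥-elim)
open import Data.Fin as Fin using (Fin)
open import Data.Fin.Properties using (suc-injective)
import Data.Integer as ℤ
import Data.Integer.Properties as ℤ
open import Data.List using (_∷_)
open import Data.Nat using (zero; suc)
open import Data.Nat.Coprimality as Coprime using (1-coprimeTo)
open import Data.Product using (_×_; _,_; proj₁; proj₂)
open import Data.Product.Properties using (≡-dec)
open import Data.Rational
  using (mkℚ; _+_; _*_; -_; _/_; 1/_; ≢-nonZero; positive; negative; nonNegative; nonPositive)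
open import Data.Rational.Properties
open import Data.Sum using (inj₁; inj₂)
open import Function using (_∘_)
open import Level using (0ℓ)
open import Relation.Binary.Definitions using (tri<; tri≈; tri>)
open import Relation.Binary.PropositionalEquality
open import Relation.Nullary using (¬_; Dec; yes; no)
open import Relation.Nullary.Decidable using (dec⇒maybe)
open import Tactic.RingSolver using (solve-∀)
open import Tactic.RingSolver.Core.AlmostCommutativeRing
  using (AlmostCommutativeRing; fromCommutativeRing)
open import Algebra.Properties.Semiring.Sum (CommutativeRing.semiring +-*-commutativeRing)
  using (sum; sum-cong-≗; ∑-distrib-+; ∑-comm; *-distribˡ-sum)

ringℚ : AlmostCommutativeRing 0ℓ 0ℓ
ringℚ = fromCommutativeRing +-*-commutativeRing (λ x → dec⇒maybe (0ℚ ≟ x))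

fromℕ : ℕ → ℚ
fromℕ k = ℤ.+ k / 1

fromℕ-suc : ∀ k → 1ℚ + fromℕ k ≡ fromℕ (suc k)
fromℕ-suc k = begin
  1ℚ + fromℕ k                         ≡⟨ cong (1ℚ +_) (normalize-coprime (Coprime.sym (1-coprimeTo k))) ⟩
  (ℤ.+ 1 ℤ.+ ℤ.+ k ℤ.* ℤ.+ 1) / 1     ≡⟨ /-cong (cong (ℤ._+_ (ℤ.+ 1)) (ℤ.*-identityʳ (ℤ.+ k))) refl ⟩
  fromℕ (suc k)                        ∎
  where open ≡-Reasoning

invℕ-inverse : ∀ k → invℕ (suc k) * fromℕ (suc k) ≡ 1ℚ
invℕ-inverse k =
  trans (cong₂ _*_ (normalize-coprime (1-coprimeTo (suc k))) (normalize-coprime k-coprime))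
        (*-inverseˡ (mkℚ (ℤ.+ suc k) 0 k-coprime))
  where k-coprime = Coprime.sym (1-coprimeTo (suc k))

-- Once both factors are in normal form the product reduces to + 1 / (suc m * suc n).
invℕ-* : ∀ m n → invℕ (suc m ℕ.* suc n) ≡ invℕ (suc m) * invℕ (suc n)
invℕ-* m n = sym (cong₂ _*_ (normalize-coprime (1-coprimeTo (suc m)))
                            (normalize-coprime (1-coprimeTo (suc n))))

invℕ-nonNeg : ∀ k → 0ℚ ≤ invℕ k
invℕ-nonNeg zero    = ≤-refl
invℕ-nonNeg (suc k) = nonNegative⁻¹ _ {{normalize-nonNeg 1 (suc k)}}

recip-≢0 : ∀ {p} (p≢0 : p ≢ 0ℚ) → recip p ≡ (1/ p) {{≢-nonZero p≢0}}
recip-≢0 {p} p≢0 with p ≟ 0ℚ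
... | yes p≡0 = ⊥-elim (p≢0 p≡0)
... | no  _   = refl

recip-involutive : ∀ {p} → p ≢ 0ℚ → recip (recip p) ≡ p
recip-involutive {p} p≢0 = begin
  recip (recip p)   ≡⟨ cong recip (recip-≢0 p≢0) ⟩
  recip (1/ p)      ≡⟨ recip-≢0 1/p≢0 ⟩
  1/ (1/ p)         ≡⟨ 1/-involutive p ⟩
  p                 ∎
  where
  open ≡-Reasoning
  instance
    _ = ≢-nonZero p≢0
    _ = nonZero⇒1/nonZero p
  1/p≢0 : 1/ p ≢ 0ℚ
  1/p≢0 1/p≡0 = 1≢0 (trans (sym (*-inverseʳ p)) (trans (cong (p *_) 1/p≡0) (*-zeroʳ p)))

recip-inverse : ∀ {p} → p ≢ 0ℚ → p * recip p ≡ 1ℚ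
recip-inverse {p} p≢0 = trans (cong (p *_) (recip-≢0 p≢0)) (*-inverseʳ p {{≢-nonZero p≢0}})

*-nonNeg : ∀ {p q} → 0ℚ ≤ p → 0ℚ ≤ q → 0ℚ ≤ p * q
*-nonNeg {p} {q} 0≤p 0≤q = nonNegative⁻¹ _ {{nonNeg*nonNeg⇒nonNeg p {{nonNegative 0≤p}} q {{nonNegative 0≤q}}}}

square-nonNeg : ∀ p → 0ℚ ≤ p * p
square-nonNeg p with ≤-total 0ℚ p
... | inj₁ 0≤p = *-nonNeg 0≤p 0≤p
... | inj₂ p≤0 = nonNegative⁻¹ _ {{nonPos*nonPos⇒nonPos p {{nonPositive p≤0}} p {{nonPositive p≤0}}}}

square-nonPos⇒≡0 : ∀ p → p * p ≤ 0ℚ → p ≡ 0ℚ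
square-nonPos⇒≡0 p p²≤0 with <-cmp p 0ℚ
... | tri< p<0 _ _ = ⊥-elim (<-irrefl refl (<-≤-trans
        (positive⁻¹ _ {{neg*neg⇒pos p {{negative p<0}} p {{negative p<0}}}}) p²≤0))
... | tri≈ _ p≡0 _ = p≡0
... | tri> _ _ p>0 = ⊥-elim (<-irrefl refl (<-≤-trans
        (positive⁻¹ _ {{pos*pos⇒pos p {{positive p>0}} p {{positive p>0}}}}) p²≤0))

0≤q-p⇒p≤q : ∀ {p q} → 0ℚ ≤ q - p → p ≤ q
0≤q-p⇒p≤q {p} {q} 0≤q-p = subst₂ _≤_ (+-identityʳ p) (p+[q-p]≡q p q) (+-monoʳ-≤ p 0≤q-p)
  where
  p+[q-p]≡q : ∀ p q → p + (q - p) ≡ q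
  p+[q-p]≡q = solve-∀ ringℚ

p≤p+q : ∀ {p q} → 0ℚ ≤ q → p ≤ p + q
p≤p+q {p} {q} 0≤q = subst (_≤ p + q) (+-identityʳ p) (+-monoʳ-≤ p 0≤q)

q≤p+q : ∀ {p q} → 0ℚ ≤ p → q ≤ p + q
q≤p+q {p} {q} 0≤p = subst (_≤ p + q) (+-identityˡ q) (+-monoˡ-≤ q 0≤p)

p<q⇒0<q-p : ∀ {p q} → p < q → 0ℚ < q - p
p<q⇒0<q-p {p} {q} h = subst (_< q - p) (+-inverseʳ p) (+-monoˡ-< (- p) h)

sumFin≗sum : ∀ n (f : Fin n → ℚ) → sumFin n f ≡ sum f
sumFin≗sum zero    f = refl
sumFin≗sum (suc n) f = cong (f Fin.zero +_) (sumFin≗sum n (f ∘ Fin.suc))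

sumFin-cong : ∀ n {f g : Fin n → ℚ} → (∀ i → f i ≡ g i) → sumFin n f ≡ sumFin n g
sumFin-cong n {f} {g} f≗g = begin
  sumFin n f ≡⟨ sumFin≗sum n f ⟩
  sum f      ≡⟨ sum-cong-≗ f≗g ⟩
  sum g      ≡⟨ sumFin≗sum n g ⟨
  sumFin n g ∎
  where open ≡-Reasoning

sumFin-distrib-+ : ∀ n (f g : Fin n → ℚ) →
  sumFin n (λ i → f i + g i) ≡ sumFin n f + sumFin n g
sumFin-distrib-+ n f g = begin
  sumFin n (λ i → f i + g i) ≡⟨ sumFin≗sum n _ ⟩
  sum (λ i → f i + g i)      ≡⟨ ∑-distrib-+ f g ⟩
  sum f + sum g              ≡⟨ cong₂ _+_ (sumFin≗sum n f) (sumFin≗sum n g) ⟨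
  sumFin n f + sumFin n g    ∎
  where open ≡-Reasoning

*-distribˡ-sumFin : ∀ n a (f : Fin n → ℚ) → a * sumFin n f ≡ sumFin n (λ i → a * f i)
*-distribˡ-sumFin n a f = begin
  a * sumFin n f            ≡⟨ cong (a *_) (sumFin≗sum n f) ⟩
  a * sum f                 ≡⟨ *-distribˡ-sum a f ⟩
  sum (λ i → a * f i)       ≡⟨ sumFin≗sum n _ ⟨
  sumFin n (λ i → a * f i)  ∎
  where open ≡-Reasoning

*-distribʳ-sumFin : ∀ n a (f : Fin n → ℚ) → sumFin n f * a ≡ sumFin n (λ i → f i * a)
*-distribʳ-sumFin n a f =
  trans (*-comm _ a) (trans (*-distribˡ-sumFin n a f) (sumFin-cong n (λ i → *-comm a (f i))))

sumFin-distrib-sub : ∀ n (f g : Fin n → ℚ) →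
  sumFin n (λ i → f i - g i) ≡ sumFin n f - sumFin n g
sumFin-distrib-sub n f g = begin
  sumFin n (λ i → f i - g i)                 ≡⟨ sumFin-cong n (λ i → minus-as-scaling (f i) (g i)) ⟩
  sumFin n (λ i → f i + - 1ℚ * g i)          ≡⟨ sumFin-distrib-+ n f _ ⟩
  sumFin n f + sumFin n (λ i → - 1ℚ * g i)   ≡⟨ cong (sumFin n f +_) (*-distribˡ-sumFin n (- 1ℚ) g) ⟨
  sumFin n f + - 1ℚ * sumFin n g             ≡⟨ minus-as-scaling (sumFin n f) (sumFin n g) ⟨
  sumFin n f - sumFin n g                    ∎
  where
  open ≡-Reasoning
  minus-as-scaling : ∀ a b → a - b ≡ a + - 1ℚ * b
  minus-as-scaling = solve-∀ ringℚ

sumFin-comm : ∀ m n (f : Fin m → Fin n → ℚ) →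
  sumFin m (λ i → sumFin n (f i)) ≡ sumFin n (λ j → sumFin m (λ i → f i j))
sumFin-comm m n f = begin
  sumFin m (λ i → sumFin n (f i))             ≡⟨ sumFin-cong m (λ i → sumFin≗sum n (f i)) ⟩
  sumFin m (λ i → sum (f i))                  ≡⟨ sumFin≗sum m _ ⟩
  sum (λ i → sum (f i))                       ≡⟨ ∑-comm f ⟩
  sum (λ j → sum (λ i → f i j))               ≡⟨ sumFin≗sum n _ ⟨
  sumFin n (λ j → sum (λ i → f i j))          ≡⟨ sumFin-cong n (λ j → sumFin≗sum m (λ i → f i j)) ⟨
  sumFin n (λ j → sumFin m (λ i → f i j))     ∎
  where open ≡-Reasoning

sumFin-const : ∀ n a → sumFin n (λ _ → a) ≡ fromℕ n * a
sumFin-const zero    a = sym (*-zeroˡ a)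
sumFin-const (suc n) a = begin
  a + sumFin n (λ _ → a)    ≡⟨ cong (a +_) (sumFin-const n a) ⟩
  a + fromℕ n * a           ≡⟨ a+ka≡[1+k]a a (fromℕ n) ⟩
  (1ℚ + fromℕ n) * a        ≡⟨ cong (_* a) (fromℕ-suc n) ⟩
  fromℕ (suc n) * a         ∎
  where
  open ≡-Reasoning
  a+ka≡[1+k]a : ∀ a k → a + k * a ≡ (1ℚ + k) * a
  a+ka≡[1+k]a = solve-∀ ringℚ

sumFin-zero : ∀ n {f : Fin n → ℚ} → (∀ i → f i ≡ 0ℚ) → sumFin n f ≡ 0ℚ
sumFin-zero n f≗0 = trans (sumFin-cong n f≗0) (trans (sumFin-const n 0ℚ) (*-zeroʳ (fromℕ n)))

sumFin-single : ∀ n {f : Fin n → ℚ} (v : Fin n) → (∀ w → w ≢ v → f w ≡ 0ℚ) → sumFin n f ≡ f v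
sumFin-single (suc n) {f} Fin.zero    off-v =
  trans (cong (f Fin.zero +_) (sumFin-zero n (λ w → off-v (Fin.suc w) λ ())))
        (+-identityʳ (f Fin.zero))
sumFin-single (suc n) {f} (Fin.suc v) off-v =
  trans (cong₂ _+_ (off-v Fin.zero λ ()) (sumFin-single n v (λ w w≢v → off-v (Fin.suc w) (w≢v ∘ suc-injective))))
        (+-identityˡ (f (Fin.suc v)))

sumFin-mono-≤ : ∀ n {f g : Fin n → ℚ} → (∀ i → f i ≤ g i) → sumFin n f ≤ sumFin n g
sumFin-mono-≤ zero    f≤g = ≤-refl
sumFin-mono-≤ (suc n) f≤g = +-mono-≤ (f≤g Fin.zero) (sumFin-mono-≤ n (f≤g ∘ Fin.suc))

sumFin-sandwich : ∀ n {a b w} (f g : Fin n → ℚ) → 0ℚ ≤ w →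
  (∀ u → (a * f u ≤ g u) × (g u ≤ b * f u)) →
  (a * sumFin n (λ u → w * f u) ≤ sumFin n (λ u → w * g u)) ×
  (sumFin n (λ u → w * g u) ≤ b * sumFin n (λ u → w * f u))
sumFin-sandwich n {a} {b} {w} f g 0≤w f~g =
  subst (_≤ _) (sym (rescale a)) (sumFin-mono-≤ n (λ u → weigh (proj₁ (f~g u)))) ,
  subst (_ ≤_) (sym (rescale b)) (sumFin-mono-≤ n (λ u → weigh (proj₂ (f~g u))))
  where
  weigh = *-monoˡ-≤-nonNeg w {{nonNegative 0≤w}}
  swap : ∀ a w f → a * (w * f) ≡ w * (a * f)
  swap = solve-∀ ringℚ
  rescale : ∀ c → c * sumFin n (λ u → w * f u) ≡ sumFin n (λ u → w * (c * f u))
  rescale c = trans (*-distribˡ-sumFin n c _) (sumFin-cong n (λ u → swap c w (f u)))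

normSq-nonNeg : ∀ {n} (x : Vector n) → 0ℚ ≤ normSq x
normSq-nonNeg {n} x =
  subst (_≤ normSq x) (sumFin-zero n (λ _ → refl)) (sumFin-mono-≤ n (λ v → square-nonNeg (x v)))

δ-refl : ∀ {n} (v : Fin n) → δ v v ≡ 1ℚ
δ-refl v with v Fin.≟ v
... | yes _   = refl
... | no v≢v  = ⊥-elim (v≢v refl)

δ-≢ : ∀ {n} {v w : Fin n} → v ≢ w → δ v w ≡ 0ℚ
δ-≢ {v = v} {w} v≢w with v Fin.≟ w
... | yes v≡w = ⊥-elim (v≢w v≡w)
... | no  _   = refl

sumFin-δ : ∀ n (v : Fin n) (g : Fin n → ℚ) → sumFin n (λ w → δ v w * g w) ≡ g v
sumFin-δ n v g =
  trans (sumFin-single n v (λ w w≢v → trans (cong (_* g w) (δ-≢ (w≢v ∘ sym))) (*-zeroˡ (g w))))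
        (trans (cong (_* g v) (δ-refl v)) (*-identityˡ (g v)))

sumFin-δ-count : ∀ {n k} (e : Fin k → Fin n) (x : Vector n) →
  sumFin n (λ w → sumFin k (λ i → δ (e i) w) * x w) ≡ sumFin k (x ∘ e)
sumFin-δ-count {n} {k} e x = begin
  sumFin n (λ w → sumFin k (λ i → δ (e i) w) * x w)   ≡⟨ sumFin-cong n (λ w → *-distribʳ-sumFin k (x w) _) ⟩
  sumFin n (λ w → sumFin k (λ i → δ (e i) w * x w))   ≡⟨ sumFin-comm n k _ ⟩
  sumFin k (λ i → sumFin n (λ w → δ (e i) w * x w))   ≡⟨ sumFin-cong k (λ i → sumFin-δ n (e i) x) ⟩
  sumFin k (x ∘ e)                                     ∎
  where open ≡-Reasoning

-- Sums over the half-edges of a rotation map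

sumPairs : ∀ n d → (Fin n × Fin d → ℚ) → ℚ
sumPairs n d f = sumFin n (λ v → sumFin d (λ i → f (v , i)))

sumPairs-cong : ∀ {n d} {f g : Fin n × Fin d → ℚ} → (∀ p → f p ≡ g p) → sumPairs n d f ≡ sumPairs n d g
sumPairs-cong {n} {d} f≗g = sumFin-cong n (λ v → sumFin-cong d (λ i → f≗g (v , i)))

sumPairs-comm : ∀ {n d} (f : Fin n × Fin d → Fin n × Fin d → ℚ) →
  sumPairs n d (λ p → sumPairs n d (f p)) ≡ sumPairs n d (λ q → sumPairs n d (λ p → f p q))
sumPairs-comm {n} {d} f = begin
  sumFin n (λ v → sumFin d (λ i → sumFin n (λ w → sumFin d (λ j → f (v , i) (w , j)))))
    ≡⟨ sumFin-cong n (λ v → sumFin-comm d n _) ⟩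
  sumFin n (λ v → sumFin n (λ w → sumFin d (λ i → sumFin d (λ j → f (v , i) (w , j)))))
    ≡⟨ sumFin-comm n n _ ⟩
  sumFin n (λ w → sumFin n (λ v → sumFin d (λ i → sumFin d (λ j → f (v , i) (w , j)))))
    ≡⟨ sumFin-cong n (λ w → sumFin-cong n (λ v → sumFin-comm d d _)) ⟩
  sumFin n (λ w → sumFin n (λ v → sumFin d (λ j → sumFin d (λ i → f (v , i) (w , j)))))
    ≡⟨ sumFin-cong n (λ w → sumFin-comm n d _) ⟩
  sumFin n (λ w → sumFin d (λ j → sumFin n (λ v → sumFin d (λ i → f (v , i) (w , j)))))
    ∎
  where open ≡-Reasoning

δ₂ : ∀ {n d} → Fin n × Fin d → Fin n × Fin d → ℚ
δ₂ (v , i) (w , j) = δ v w * δ i j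

δ₂-refl : ∀ {n d} (p : Fin n × Fin d) → δ₂ p p ≡ 1ℚ
δ₂-refl (v , i) = trans (cong₂ _*_ (δ-refl v) (δ-refl i)) (*-identityˡ 1ℚ)

δ₂-≢ : ∀ {n d} {p q : Fin n × Fin d} → p ≢ q → δ₂ p q ≡ 0ℚ
δ₂-≢ {p = v , i} {w , j} p≢q = by-cases (v Fin.≟ w)
  where
  by-cases : Dec (v ≡ w) → δ v w * δ i j ≡ 0ℚ
  by-cases (no v≢w)  = trans (cong (_* δ i j) (δ-≢ {v = v} {w} v≢w)) (*-zeroˡ (δ i j))
  by-cases (yes refl) = trans (cong (δ v v *_) (δ-≢ {v = i} {j} (λ { refl → p≢q refl }))) (*-zeroʳ (δ v v))

sumPairs-δ₂ : ∀ {n d} (p : Fin n × Fin d) (g : Fin n × Fin d → ℚ) →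
  sumPairs n d (λ q → δ₂ p q * g q) ≡ g p
sumPairs-δ₂ {n} {d} (v , i) g = begin
  sumFin n (λ w → sumFin d (λ j → δ v w * δ i j * g (w , j)))
    ≡⟨ sumFin-cong n (λ w → sumFin-cong d (λ j → *-assoc (δ v w) _ _)) ⟩
  sumFin n (λ w → sumFin d (λ j → δ v w * (δ i j * g (w , j))))
    ≡⟨ sumFin-cong n (λ w → *-distribˡ-sumFin d (δ v w) _) ⟨
  sumFin n (λ w → δ v w * sumFin d (λ j → δ i j * g (w , j)))
    ≡⟨ sumFin-cong n (λ w → cong (δ v w *_) (sumFin-δ d i _)) ⟩
  sumFin n (λ w → δ v w * g (w , i))
    ≡⟨ sumFin-δ n v _ ⟩
  g (v , i)
    ∎
  where open ≡-Reasoning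

module _ {n d} (rot : RotMap n d) (rot-involutive : IsRotMap rot) where

  δ₂-rot : ∀ p q → δ₂ (rot p) q ≡ δ₂ (rot q) p
  δ₂-rot p q with ≡-dec Fin._≟_ Fin._≟_ (rot p) q
  ... | yes refl rewrite rot-involutive p = trans (δ₂-refl (rot p)) (sym (δ₂-refl p))
  ... | no rot-p≢q = trans (δ₂-≢ rot-p≢q) (sym (δ₂-≢ λ rot-q≡p →
          rot-p≢q (trans (cong rot (sym rot-q≡p)) (rot-involutive q))))

  sumPairs-rot : (f : Fin n × Fin d → ℚ) → sumPairs n d (f ∘ rot) ≡ sumPairs n d f
  sumPairs-rot f = begin
    sumPairs n d (f ∘ rot)
      ≡⟨ sumPairs-cong (λ p → sumPairs-δ₂ (rot p) f) ⟨
    sumPairs n d (λ p → sumPairs n d (λ q → δ₂ (rot p) q * f q))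
      ≡⟨ sumPairs-comm (λ p q → δ₂ (rot p) q * f q) ⟩
    sumPairs n d (λ q → sumPairs n d (λ p → δ₂ (rot p) q * f q))
      ≡⟨ sumPairs-cong (λ q → sumPairs-cong (λ p → cong (_* f q) (δ₂-rot p q))) ⟩
    sumPairs n d (λ q → sumPairs n d (λ p → δ₂ (rot q) p * f q))
      ≡⟨ sumPairs-cong (λ q → sumPairs-δ₂ (rot q) (λ _ → f q)) ⟩
    sumPairs n d f
      ∎
    where open ≡-Reasoning

  sumPairs-swap-rot : (F : Fin n × Fin d → Fin n × Fin d → ℚ) →
    sumPairs n d (λ p → F p (rot p)) ≡ sumPairs n d (λ p → F (rot p) p)
  sumPairs-swap-rot F =
    trans (sumPairs-cong (λ p → cong (λ q → F q (rot p)) (sym (rot-involutive p))))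
          (sumPairs-rot (λ p → F (rot p) p))

dot-congʳ : ∀ {n} (x : Vector n) {y y′ : Vector n} → (∀ v → y v ≡ y′ v) → dot x y ≡ dot x y′
dot-congʳ {n} x y≗y′ = sumFin-cong n (λ v → cong (x v *_) (y≗y′ v))

dot-scaleʳ : ∀ {n} (x : Vector n) a (y : Vector n) → dot x (λ v → a * y v) ≡ a * dot x y
dot-scaleʳ {n} x a y =
  trans (sumFin-cong n (λ v → x*[a*y]≡a*[x*y] (x v) a (y v))) (sym (*-distribˡ-sumFin n a _))
  where
  x*[a*y]≡a*[x*y] : ∀ x a y → x * (a * y) ≡ a * (x * y)
  x*[a*y]≡a*[x*y] = solve-∀ ringℚ

dot-shift : ∀ {n} (z w : Vector n) a →
  dot (λ i → z i + a) (λ i → w i + a) ≡ dot z w + a * sumFin n z + a * sumFin n w + fromℕ n * (a * a)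
dot-shift {n} z w a = begin
  sumFin n (λ i → (z i + a) * (w i + a))
    ≡⟨ sumFin-cong n (λ i → expand (z i) (w i) a) ⟩
  sumFin n (λ i → z i * w i + a * z i + a * w i + a * a)
    ≡⟨ sumFin-distrib-+ n _ _ ⟩
  sumFin n (λ i → z i * w i + a * z i + a * w i) + sumFin n (λ _ → a * a)
    ≡⟨ cong₂ _+_ (sumFin-distrib-+ n _ _) (sumFin-const n (a * a)) ⟩
  sumFin n (λ i → z i * w i + a * z i) + sumFin n (λ i → a * w i) + fromℕ n * (a * a)
    ≡⟨ cong (λ t → t + sumFin n (λ i → a * w i) + fromℕ n * (a * a)) (sumFin-distrib-+ n _ _) ⟩
  dot z w + sumFin n (λ i → a * z i) + sumFin n (λ i → a * w i) + fromℕ n * (a * a)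
    ≡⟨ cong₂ (λ s t → dot z w + s + t + fromℕ n * (a * a))
             (*-distribˡ-sumFin n a z) (*-distribˡ-sumFin n a w) ⟨
  dot z w + a * sumFin n z + a * sumFin n w + fromℕ n * (a * a)
    ∎
  where
  open ≡-Reasoning
  expand : ∀ z w a → (z + a) * (w + a) ≡ z * w + a * z + a * w + a * a
  expand = solve-∀ ringℚ

normSq-combination : ∀ {n} a b (z w : Vector n) →
  normSq (λ k → a * z k + b * w k) ≡ a * a * normSq z + (a * b + a * b) * dot z w + b * b * normSq w
normSq-combination {n} a b z w = begin
  sumFin n (λ k → (a * z k + b * w k) * (a * z k + b * w k))
    ≡⟨ sumFin-cong n (λ k → expand a b (z k) (w k)) ⟩
  sumFin n (λ k → a * a * (z k * z k) + (a * b + a * b) * (z k * w k) + b * b * (w k * w k))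
    ≡⟨ sumFin-distrib-+ n _ _ ⟩
  sumFin n (λ k → a * a * (z k * z k) + (a * b + a * b) * (z k * w k)) + sumFin n (λ k → b * b * (w k * w k))
    ≡⟨ cong (_+ _) (sumFin-distrib-+ n _ _) ⟩
  sumFin n (λ k → a * a * (z k * z k)) + sumFin n (λ k → (a * b + a * b) * (z k * w k))
    + sumFin n (λ k → b * b * (w k * w k))
    ≡⟨ cong₂ _+_ (cong₂ _+_ (*-distribˡ-sumFin n (a * a) _) (*-distribˡ-sumFin n (a * b + a * b) _))
                 (*-distribˡ-sumFin n (b * b) _) ⟨
  a * a * normSq z + (a * b + a * b) * dot z w + b * b * normSq w
    ∎
  where
  open ≡-Reasoning
  expand : ∀ a b z w →
    (a * z + b * w) * (a * z + b * w) ≡ a * a * (z * z) + (a * b + a * b) * (z * w) + b * b * (w * w)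
  expand = solve-∀ ringℚ

normSq-nonPos⇒≡0 : ∀ {n} (w : Vector n) → normSq w ≤ 0ℚ → ∀ k → w k ≡ 0ℚ
normSq-nonPos⇒≡0 w ‖w‖²≤0 Fin.zero =
  square-nonPos⇒≡0 (w Fin.zero) (≤-trans (p≤p+q (normSq-nonNeg (w ∘ Fin.suc))) ‖w‖²≤0)
normSq-nonPos⇒≡0 w ‖w‖²≤0 (Fin.suc k) =
  normSq-nonPos⇒≡0 (w ∘ Fin.suc) (≤-trans (q≤p+q (square-nonNeg (w Fin.zero))) ‖w‖²≤0) k

quad-cong : ∀ {n} (A : Matrix n) {x y : Vector n} → (∀ v → x v ≡ y v) → quad A x ≡ quad A y
quad-cong {n} A x≗y =
  sumFin-cong n (λ v → cong₂ _*_ (x≗y v) (sumFin-cong n (λ w → cong (A v w *_) (x≗y w))))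

*V-·M : ∀ {n} a (A : Matrix n) x v → ((a ·M A) *V x) v ≡ a * (A *V x) v
*V-·M {n} a A x v = trans (sumFin-cong n (λ w → *-assoc a (A v w) (x w))) (sym (*-distribˡ-sumFin n a _))

*V-distrib-+ : ∀ {n} (A : Matrix n) x y v → (A *V (λ w → x w + y w)) v ≡ (A *V x) v + (A *V y) v
*V-distrib-+ {n} A x y v =
  trans (sumFin-cong n (λ w → *-distribˡ-+ (A v w) (x w) (y w))) (sumFin-distrib-+ n _ _)

*M-*V : ∀ {n} (A B : Matrix n) x v → ((A *M B) *V x) v ≡ (A *V (B *V x)) v
*M-*V {n} A B x v = begin
  sumFin n (λ w → sumFin n (λ u → A v u * B u w) * x w)
    ≡⟨ sumFin-cong n (λ w → *-distribʳ-sumFin n (x w) _) ⟩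
  sumFin n (λ w → sumFin n (λ u → A v u * B u w * x w))
    ≡⟨ sumFin-comm n n _ ⟩
  sumFin n (λ u → sumFin n (λ w → A v u * B u w * x w))
    ≡⟨ sumFin-cong n (λ u → sumFin-cong n (λ w → *-assoc (A v u) _ _)) ⟩
  sumFin n (λ u → sumFin n (λ w → A v u * (B u w * x w)))
    ≡⟨ sumFin-cong n (λ u → *-distribˡ-sumFin n (A v u) _) ⟨
  sumFin n (λ u → A v u * (B *V x) u)
    ∎
  where open ≡-Reasoning

quad-·M : ∀ {n} a (A : Matrix n) x → quad (a ·M A) x ≡ a * quad A x
quad-·M a A x = trans (dot-congʳ x (*V-·M a A x)) (dot-scaleʳ x a (A *V x))

quad-idM-M : ∀ {n} (B : Matrix n) x → quad (idM -M B) x ≡ normSq x - quad B x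
quad-idM-M {n} B x = trans (sumFin-cong n distrib) (sumFin-distrib-sub n _ _)
  where
  x*[y-z]≡x*y-x*z : ∀ x y z → x * (y - z) ≡ x * y - x * z
  x*[y-z]≡x*y-x*z = solve-∀ ringℚ
  [y-z]*x≡y*x-z*x : ∀ x y z → (y - z) * x ≡ y * x - z * x
  [y-z]*x≡y*x-z*x = solve-∀ ringℚ
  *V-idM-M : ∀ v → ((idM -M B) *V x) v ≡ x v - (B *V x) v
  *V-idM-M v = trans (sumFin-cong n (λ w → [y-z]*x≡y*x-z*x (x w) (δ v w) (B v w)))
                     (trans (sumFin-distrib-sub n _ _) (cong (_- (B *V x) v) (sumFin-δ n v x)))
  distrib : ∀ v → x v * ((idM -M B) *V x) v ≡ x v * x v - x v * (B *V x) v
  distrib v = trans (cong (x v *_) (*V-idM-M v)) (x*[y-z]≡x*y-x*z (x v) (x v) ((B *V x) v))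

avg : ∀ {d} → Vector d → ℚ
avg {d} y = invℕ d * sumFin d y

fromℕ-*-avg : ∀ d (y : Vector (suc d)) → fromℕ (suc d) * avg y ≡ sumFin (suc d) y
fromℕ-*-avg d y = begin
  fromℕ (suc d) * (invℕ (suc d) * sumFin (suc d) y)
    ≡⟨ *-assoc (fromℕ (suc d)) _ _ ⟨
  fromℕ (suc d) * invℕ (suc d) * sumFin (suc d) y
    ≡⟨ cong (_* sumFin (suc d) y) (trans (*-comm (fromℕ (suc d)) (invℕ (suc d))) (invℕ-inverse d)) ⟩
  1ℚ * sumFin (suc d) y
    ≡⟨ *-identityˡ _ ⟩
  sumFin (suc d) y
    ∎
  where open ≡-Reasoning

avg-const : ∀ d a → avg {suc d} (λ _ → a) ≡ a
avg-const d a = begin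
  invℕ (suc d) * sumFin (suc d) (λ _ → a)    ≡⟨ cong (invℕ (suc d) *_) (sumFin-const (suc d) a) ⟩
  invℕ (suc d) * (fromℕ (suc d) * a)         ≡⟨ *-assoc (invℕ (suc d)) _ _ ⟨
  invℕ (suc d) * fromℕ (suc d) * a           ≡⟨ cong (_* a) (invℕ-inverse d) ⟩
  1ℚ * a                                     ≡⟨ *-identityˡ a ⟩
  a                                          ∎
  where open ≡-Reasoning

center : ∀ {d} → Vector d → Vector d
center y i = y i - avg y

center-+-avg : ∀ {d} (y : Vector d) i → y i ≡ center y i + avg y
center-+-avg y i = y≡y-m+m (y i) (avg y)
  where
  y≡y-m+m : ∀ y m → y ≡ y - m + m
  y≡y-m+m = solve-∀ ringℚ

sumFin-center : ∀ d (y : Vector (suc d)) → sumFin (suc d) (center y) ≡ 0ℚ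
sumFin-center d y = begin
  sumFin (suc d) (λ i → y i - avg y)
    ≡⟨ sumFin-distrib-sub (suc d) y (λ _ → avg y) ⟩
  sumFin (suc d) y - sumFin (suc d) (λ _ → avg y)
    ≡⟨ cong (λ t → sumFin (suc d) y - t) (sumFin-const (suc d) (avg y)) ⟩
  sumFin (suc d) y - fromℕ (suc d) * avg y
    ≡⟨ cong (λ t → sumFin (suc d) y - t) (fromℕ-*-avg d y) ⟩
  sumFin (suc d) y - sumFin (suc d) y
    ≡⟨ +-inverseʳ (sumFin (suc d) y) ⟩
  0ℚ
    ∎
  where open ≡-Reasoning

normSq-center : ∀ d (y : Vector (suc d)) →
  normSq y ≡ normSq (center y) + fromℕ (suc d) * (avg y * avg y)
normSq-center d y = begin
  normSq y
    ≡⟨ sumFin-cong (suc d) (λ i → cong₂ _*_ (center-+-avg y i) (center-+-avg y i)) ⟩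
  dot (λ i → z i + m) (λ i → z i + m)
    ≡⟨ dot-shift z z m ⟩
  normSq z + m * sumFin (suc d) z + m * sumFin (suc d) z + fromℕ (suc d) * (m * m)
    ≡⟨ cong (λ s → normSq z + m * s + m * s + fromℕ (suc d) * (m * m)) (sumFin-center d y) ⟩
  normSq z + m * 0ℚ + m * 0ℚ + fromℕ (suc d) * (m * m)
    ≡⟨ drop-zeros (normSq z) m (fromℕ (suc d) * (m * m)) ⟩
  normSq z + fromℕ (suc d) * (m * m)
    ∎
  where
  open ≡-Reasoning
  m = avg y
  z = center y
  drop-zeros : ∀ E m K → E + m * 0ℚ + m * 0ℚ + K ≡ E + K
  drop-zeros = solve-∀ ringℚ

variance : ∀ d (y : Vector (suc d)) →
  avg (λ i → y i * y i) - avg y * avg y ≡ invℕ (suc d) * normSq (center y)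
variance d y = begin
  i * normSq y - m²                     ≡⟨ cong (λ t → i * t - m²) (normSq-center d y) ⟩
  i * (normSq z + N * m²) - m²          ≡⟨ expand i (normSq z) N m² ⟩
  i * normSq z + (i * N - 1ℚ) * m²      ≡⟨ cong (λ t → i * normSq z + (t - 1ℚ) * m²) (invℕ-inverse d) ⟩
  i * normSq z + (1ℚ - 1ℚ) * m²         ≡⟨ cancel (i * normSq z) m² ⟩
  i * normSq z                          ∎
  where
  open ≡-Reasoning
  i = invℕ (suc d)
  N = fromℕ (suc d)
  m² = avg y * avg y
  z = center y
  expand : ∀ i E N M → i * (E + N * M) - M ≡ i * E + (i * N - 1ℚ) * M
  expand = solve-∀ ringℚ
  cancel : ∀ a M → a + (1ℚ - 1ℚ) * M ≡ a
  cancel = solve-∀ ringℚ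

localView : ∀ {n d} → RotMap n d → Vector n → Fin n → Vector d
localView rot x u i = x (nbr rot u i)

transM-*V : ∀ {n d} (rot : RotMap n d) x u → (transM rot *V x) u ≡ avg (localView rot x u)
transM-*V {n} {d} rot x u =
  trans (*V-·M (invℕ d) (λ v w → sumFin d (λ i → δ (nbr rot v i) w)) x u)
        (cong (invℕ d *_) (sumFin-δ-count (nbr rot u) x))

dsTransM-*V : ∀ {n d c} (rotG : RotMap n d) (rotH : RotMap d c) x v →
  (dsTransM rotG rotH *V x) v ≡
  invℕ (d ℕ.* c) * sumFin d (λ i → sumFin c (λ j → x (proj₁ (dsRot rotG rotH (v , (i , j))))))
dsTransM-*V {n} {d} {c} rotG rotH x v =
  trans (*V-·M (invℕ (d ℕ.* c)) (λ v w → sumFin d (λ i → sumFin c (λ j → δ (end v i j) w))) x v)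
        (cong (invℕ (d ℕ.* c) *_) (begin
    sumFin n (λ w → sumFin d (λ i → sumFin c (λ j → δ (end v i j) w)) * x w)
      ≡⟨ sumFin-cong n (λ w → *-distribʳ-sumFin d (x w) _) ⟩
    sumFin n (λ w → sumFin d (λ i → sumFin c (λ j → δ (end v i j) w) * x w))
      ≡⟨ sumFin-comm n d _ ⟩
    sumFin d (λ i → sumFin n (λ w → sumFin c (λ j → δ (end v i j) w) * x w))
      ≡⟨ sumFin-cong d (λ i → sumFin-δ-count (end v i) x) ⟩
    sumFin d (λ i → sumFin c (λ j → x (end v i j)))
      ∎))
  where
  open ≡-Reasoning
  end : Fin n → Fin d → Fin c → Fin n
  end v i j = proj₁ (dsRot rotG rotH (v , (i , j)))

dot-transM : ∀ {n d} (rot : RotMap n d) g h →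
  dot g (transM rot *V h) ≡ invℕ d * sumPairs n d (λ p → g (proj₁ p) * h (proj₁ (rot p)))
dot-transM {n} {d} rot g h = begin
  dot g (transM rot *V h)
    ≡⟨ dot-congʳ g (transM-*V rot h) ⟩
  dot g (λ v → invℕ d * sumFin d (localView rot h v))
    ≡⟨ dot-scaleʳ g (invℕ d) _ ⟩
  invℕ d * dot g (λ v → sumFin d (localView rot h v))
    ≡⟨ cong (invℕ d *_) (sumFin-cong n (λ v → *-distribˡ-sumFin d (g v) _)) ⟩
  invℕ d * sumPairs n d (λ p → g (proj₁ p) * h (proj₁ (rot p)))
    ∎
  where open ≡-Reasoning

module _ {n d} (rot : RotMap n d) (rot-involutive : IsRotMap rot) where

  transM-selfAdjoint : ∀ g h → dot g (transM rot *V h) ≡ dot h (transM rot *V g)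
  transM-selfAdjoint g h = begin
    dot g (transM rot *V h)
      ≡⟨ dot-transM rot g h ⟩
    invℕ d * sumPairs n d (λ p → g (proj₁ p) * h (proj₁ (rot p)))
      ≡⟨ cong (invℕ d *_) (sumPairs-swap-rot rot rot-involutive (λ p q → g (proj₁ p) * h (proj₁ q))) ⟩
    invℕ d * sumPairs n d (λ p → g (proj₁ (rot p)) * h (proj₁ p))
      ≡⟨ cong (invℕ d *_) (sumPairs-cong (λ p → *-comm (g (proj₁ (rot p))) (h (proj₁ p)))) ⟩
    invℕ d * sumPairs n d (λ p → h (proj₁ p) * g (proj₁ (rot p)))
      ≡⟨ dot-transM rot h g ⟨
    dot h (transM rot *V g)
      ∎
    where open ≡-Reasoning

  quad-transM² : ∀ x →
    quad (transM rot *M transM rot) x ≡ sumFin n (λ u → avg (localView rot x u) * avg (localView rot x u))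
  quad-transM² x = begin
    dot x ((transM rot *M transM rot) *V x)
      ≡⟨ dot-congʳ x (*M-*V (transM rot) (transM rot) x) ⟩
    dot x (transM rot *V (transM rot *V x))
      ≡⟨ transM-selfAdjoint x (transM rot *V x) ⟩
    normSq (transM rot *V x)
      ≡⟨ sumFin-cong n (λ u → cong₂ _*_ (transM-*V rot x u) (transM-*V rot x u)) ⟩
    sumFin n (λ u → avg (localView rot x u) * avg (localView rot x u))
      ∎
    where open ≡-Reasoning

module _ {n d} (rot : RotMap n (suc d)) (rot-involutive : IsRotMap rot) where

  transM-const : ∀ a v → (transM rot *V (λ _ → a)) v ≡ a
  transM-const a v = trans (transM-*V rot (λ _ → a) v) (avg-const d a)

  sumFin-transM : ∀ f → sumFin n (transM rot *V f) ≡ sumFin n f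
  sumFin-transM f = begin
    sumFin n (transM rot *V f)             ≡⟨ sumFin-cong n (λ v → *-identityˡ ((transM rot *V f) v)) ⟨
    dot (λ _ → 1ℚ) (transM rot *V f)       ≡⟨ transM-selfAdjoint rot rot-involutive (λ _ → 1ℚ) f ⟩
    dot f (transM rot *V (λ _ → 1ℚ))       ≡⟨ dot-congʳ f (transM-const 1ℚ) ⟩
    dot f (λ _ → 1ℚ)                       ≡⟨ sumFin-cong n (λ v → *-identityʳ (f v)) ⟩
    sumFin n f                             ∎
    where open ≡-Reasoning

  normSq-localView : ∀ x → normSq x ≡ sumFin n (λ u → invℕ (suc d) * normSq (localView rot x u))
  normSq-localView x =
    trans (sym (sumFin-transM (λ v → x v * x v))) (sumFin-cong n (transM-*V rot (λ v → x v * x v)))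

  transM-shift : ∀ z a v → (transM rot *V (λ w → z w + a)) v ≡ (transM rot *V z) v + a
  transM-shift z a v = trans (*V-distrib-+ (transM rot) z (λ _ → a) v) (cong ((transM rot *V z) v +_) (transM-const a v))

  quad-laplacian-shift : ∀ z a → quad (laplacian rot) (λ k → z k + a) ≡ quad (laplacian rot) z
  quad-laplacian-shift z a = begin
    quad (laplacian rot) z+a
      ≡⟨ quad-idM-M M z+a ⟩
    normSq z+a - dot z+a (M *V z+a)
      ≡⟨ cong (λ t → normSq z+a - t) (dot-congʳ z+a (transM-shift z a)) ⟩
    normSq z+a - dot z+a (λ k → Mz k + a)
      ≡⟨ cong₂ _-_ (dot-shift z z a) (dot-shift z Mz a) ⟩
    (normSq z + S + S + K) - (dot z Mz + S + a * sumFin n Mz + K)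
      ≡⟨ cong (λ t → (normSq z + S + S + K) - (dot z Mz + S + a * t + K)) (sumFin-transM z) ⟩
    (normSq z + S + S + K) - (dot z Mz + S + S + K)
      ≡⟨ cancel (normSq z) (dot z Mz) S K ⟩
    normSq z - quad M z
      ≡⟨ quad-idM-M M z ⟨
    quad (laplacian rot) z
      ∎
    where
    open ≡-Reasoning
    M = transM rot
    Mz = M *V z
    z+a : Vector n
    z+a k = z k + a
    S = a * sumFin n z
    K = fromℕ n * (a * a)
    cancel : ∀ E D S K → (E + S + S + K) - (D + S + S + K) ≡ E - D
    cancel = solve-∀ ringℚ

  quad-laplacian-center : ∀ y → quad (laplacian rot) y ≡ quad (laplacian rot) (center y)
  quad-laplacian-center y =
    trans (quad-cong (laplacian rot) (center-+-avg y)) (quad-laplacian-shift (center y) (avg y))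

-- The two Laplacian forms as sums over local views

module _ {n d} (rotG : RotMap n (suc d)) (rotG-involutive : IsRotMap rotG) where

  quad-laplacianSq : ∀ x →
    quad (laplacianSq rotG) x ≡ sumFin n (λ u → invℕ (suc d) * normSq (center (localView rotG x u)))
  quad-laplacianSq x = begin
    quad (laplacianSq rotG) x
      ≡⟨ quad-idM-M (transM rotG *M transM rotG) x ⟩
    normSq x - quad (transM rotG *M transM rotG) x
      ≡⟨ cong₂ _-_ (normSq-localView rotG rotG-involutive x) (quad-transM² rotG rotG-involutive x) ⟩
    sumFin n (λ u → avg (λ i → y u i * y u i)) - sumFin n (λ u → avg (y u) * avg (y u))
      ≡⟨ sumFin-distrib-sub n _ _ ⟨
    sumFin n (λ u → avg (λ i → y u i * y u i) - avg (y u) * avg (y u))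
      ≡⟨ sumFin-cong n (λ u → variance d (y u)) ⟩
    sumFin n (λ u → invℕ (suc d) * normSq (center (y u)))
      ∎
    where
    open ≡-Reasoning
    y = localView rotG x

  module _ {c} (rotH : RotMap (suc d) (suc c)) (rotH-involutive : IsRotMap rotH) where

    -- The walk (v, i, j) of G Ⓢ H is re-indexed by its middle half-edge (u, k) = Rot_G (v, i).
    dsWalks-localView : ∀ x →
      dot x (λ v → sumFin (suc d) (λ i → sumFin (suc c) (λ j → x (proj₁ (dsRot rotG rotH (v , (i , j))))))) ≡
      sumFin n (λ u → sumPairs (suc d) (suc c) (λ q → localView rotG x u (proj₁ q) * localView rotG x u (proj₁ (rotH q))))
    dsWalks-localView x = begin
      sumFin n (λ v → x v * sumFin (suc d) (λ i → sumFin (suc c) (λ j → x (end v i j))))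
        ≡⟨ sumFin-cong n (λ v → trans (*-distribˡ-sumFin (suc d) (x v) (λ i → sumFin (suc c) (x ∘ end v i)))
                                      (sumFin-cong (suc d) (λ i → *-distribˡ-sumFin (suc c) (x v) (x ∘ end v i)))) ⟩
      sumPairs n (suc d) (λ p → F p (rotG p))
        ≡⟨ sumPairs-swap-rot rotG rotG-involutive F ⟩
      sumPairs n (suc d) (λ p → F (rotG p) p)
        ∎
      where
      open ≡-Reasoning
      end : Fin n → Fin (suc d) → Fin (suc c) → Fin n
      end v i j = proj₁ (dsRot rotG rotH (v , (i , j)))
      F : Fin n × Fin (suc d) → Fin n × Fin (suc d) → ℚ
      F (v , _) (u , k) = sumFin (suc c) (λ j → x v * x (nbr rotG u (nbr rotH k j)))

    quad-dsTransM : ∀ x →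
      quad (dsTransM rotG rotH) x ≡ sumFin n (λ u → invℕ (suc d) * quad (transM rotH) (localView rotG x u))
    quad-dsTransM x = begin
      quad (dsTransM rotG rotH) x
        ≡⟨ dot-congʳ x (dsTransM-*V rotG rotH x) ⟩
      dot x (λ v → invℕ (suc d ℕ.* suc c) * W v)
        ≡⟨ dot-scaleʳ x (invℕ (suc d ℕ.* suc c)) W ⟩
      invℕ (suc d ℕ.* suc c) * dot x W
        ≡⟨ cong₂ _*_ (invℕ-* d c) (dsWalks-localView x) ⟩
      invℕ (suc d) * invℕ (suc c) * sumFin n P
        ≡⟨ *-assoc (invℕ (suc d)) (invℕ (suc c)) (sumFin n P) ⟩
      invℕ (suc d) * (invℕ (suc c) * sumFin n P)
        ≡⟨ cong (invℕ (suc d) *_) (*-distribˡ-sumFin n (invℕ (suc c)) P) ⟩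
      invℕ (suc d) * sumFin n (λ u → invℕ (suc c) * P u)
        ≡⟨ *-distribˡ-sumFin n (invℕ (suc d)) _ ⟩
      sumFin n (λ u → invℕ (suc d) * (invℕ (suc c) * P u))
        ≡⟨ sumFin-cong n (λ u → cong (invℕ (suc d) *_) (dot-transM rotH (y u) (y u))) ⟨
      sumFin n (λ u → invℕ (suc d) * quad (transM rotH) (y u))
        ∎
      where
      open ≡-Reasoning
      y = localView rotG x
      W : Vector n
      W v = sumFin (suc d) (λ i → sumFin (suc c) (λ j → x (proj₁ (dsRot rotG rotH (v , (i , j))))))
      P : Fin n → ℚ
      P u = sumPairs (suc d) (suc c) (λ q → y u (proj₁ q) * y u (proj₁ (rotH q)))

    quad-dsLaplacian : ∀ x →
      quad (dsLaplacian rotG rotH) x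
        ≡ sumFin n (λ u → invℕ (suc d) * quad (laplacian rotH) (center (localView rotG x u)))
    quad-dsLaplacian x = begin
      quad (dsLaplacian rotG rotH) x
        ≡⟨ quad-idM-M (dsTransM rotG rotH) x ⟩
      normSq x - quad (dsTransM rotG rotH) x
        ≡⟨ cong₂ _-_ (normSq-localView rotG rotG-involutive x) (quad-dsTransM x) ⟩
      sumFin n (λ u → i * normSq (y u)) - sumFin n (λ u → i * quad (transM rotH) (y u))
        ≡⟨ sumFin-distrib-sub n _ _ ⟨
      sumFin n (λ u → i * normSq (y u) - i * quad (transM rotH) (y u))
        ≡⟨ sumFin-cong n (λ u → factor i (normSq (y u)) (quad (transM rotH) (y u))) ⟩
      sumFin n (λ u → i * (normSq (y u) - quad (transM rotH) (y u)))
        ≡⟨ sumFin-cong n (λ u → cong (i *_) (quad-idM-M (transM rotH) (y u))) ⟨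
      sumFin n (λ u → i * quad (laplacian rotH) (y u))
        ≡⟨ sumFin-cong n (λ u → cong (i *_) (quad-laplacian-center rotH rotH-involutive (y u))) ⟩
      sumFin n (λ u → i * quad (laplacian rotH) (center (y u)))
        ∎
      where
      open ≡-Reasoning
      i = invℕ (suc d)
      y = localView rotG x
      factor : ∀ i a b → i * a - i * b ≡ i * (a - b)
      factor = solve-∀ ringℚ

-- Spectral bounds

dot-bounded : ∀ {n α} (z w : Vector n) → 0ℚ ≤ α → normSq w ≤ α * α * normSq z →
  (0ℚ ≤ α * normSq z - dot z w) × (0ℚ ≤ α * normSq z + dot z w)
dot-bounded {n} {α} z w 0≤α ‖w‖²≤α²‖z‖² with <-cmp 0ℚ α
... | tri> _ _ α<0 = ⊥-elim (<-irrefl refl (<-≤-trans α<0 0≤α))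
-- 2α cannot be cancelled when α = 0, but then ‖w‖² ≤ 0 forces w = 0.
... | tri≈ _ refl _ =
  ≤-reflexive (sym (trans (cong₂ _-_ (*-zeroˡ (normSq z)) D≡0) (+-inverseʳ 0ℚ))) ,
  ≤-reflexive (sym (trans (cong₂ _+_ (*-zeroˡ (normSq z)) D≡0) (+-identityʳ 0ℚ)))
  where
  w≡0 : ∀ k → w k ≡ 0ℚ
  w≡0 = normSq-nonPos⇒≡0 w (subst (normSq w ≤_) (*-zeroˡ (normSq z)) ‖w‖²≤α²‖z‖²)
  D≡0 : dot z w ≡ 0ℚ
  D≡0 = trans (dot-congʳ z w≡0) (sumFin-zero n (λ k → *-zeroʳ (z k)))
... | tri< 0<α _ _ =
  subst (0ℚ ≤_) (minus-as-scaling (α * e) D) (polarized (- 1ℚ) refl) ,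
  subst (0ℚ ≤_) (cong (α * e +_) (*-identityˡ D)) (polarized 1ℚ refl)
  where
  e = normSq z
  D = dot z w
  W = normSq w
  minus-as-scaling : ∀ a b → a + - 1ℚ * b ≡ a - b
  minus-as-scaling = solve-∀ ringℚ
  factor : ∀ α s e D → α * α * e + (α * s + α * s) * D + α * α * e ≡ (α + α) * (α * e + s * D)
  factor = solve-∀ ringℚ
  polarized : ∀ s → s * s ≡ 1ℚ → 0ℚ ≤ α * e + s * D
  polarized s s²≡1 = *-cancelˡ-≤-pos (α + α) {{pos+pos⇒pos α {{positive 0<α}} α {{positive 0<α}}}} (begin
    (α + α) * 0ℚ
      ≡⟨ *-zeroʳ (α + α) ⟩
    0ℚ
      ≤⟨ normSq-nonNeg (λ k → α * z k + s * w k) ⟩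
    normSq (λ k → α * z k + s * w k)
      ≡⟨ normSq-combination α s z w ⟩
    α * α * e + (α * s + α * s) * D + s * s * W
      ≡⟨ cong (λ t → α * α * e + (α * s + α * s) * D + t * W) s²≡1 ⟩
    α * α * e + (α * s + α * s) * D + 1ℚ * W
      ≤⟨ +-monoʳ-≤ (α * α * e + (α * s + α * s) * D)
                   (subst (_≤ α * α * e) (sym (*-identityˡ W)) ‖w‖²≤α²‖z‖²) ⟩
    α * α * e + (α * s + α * s) * D + α * α * e
      ≡⟨ factor α s e D ⟩
    (α + α) * (α * e + s * D)
      ∎)
    where open ≤-Reasoning

scalar-sandwich : ∀ {α r e D} → 0ℚ ≤ α → α < 1ℚ → (1ℚ - α) * r ≡ 1ℚ → 0ℚ ≤ e →
  0ℚ ≤ α * e - D → 0ℚ ≤ α * e + D → ((1ℚ - α) * e ≤ e - D) × (e - D ≤ r * e)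
scalar-sandwich {α} {r} {e} {D} 0≤α α<1 [1-α]r≡1 0≤e 0≤αe-D 0≤αe+D =
  0≤q-p⇒p≤q (subst (0ℚ ≤_) (lower-gap α e D) 0≤αe-D) ,
  0≤q-p⇒p≤q (*-cancelˡ-≤-pos (1ℚ - α) {{positive 0<1-α}} (begin
    (1ℚ - α) * 0ℚ
      ≡⟨ *-zeroʳ (1ℚ - α) ⟩
    0ℚ
      ≤⟨ +-mono-≤ (*-nonNeg (*-nonNeg 0≤α 0≤α) 0≤e) (*-nonNeg (<⇒≤ 0<1-α) 0≤αe+D) ⟩
    α * α * e + (1ℚ - α) * (α * e + D)
      ≡⟨ upper-gap α e D ⟨
    1ℚ * e - (1ℚ - α) * (e - D)
      ≡⟨ cong (λ t → t * e - (1ℚ - α) * (e - D)) [1-α]r≡1 ⟨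
    (1ℚ - α) * r * e - (1ℚ - α) * (e - D)
      ≡⟨ distrib (1ℚ - α) r e D ⟩
    (1ℚ - α) * (r * e - (e - D))
      ∎))
  where
  open ≤-Reasoning
  0<1-α = p<q⇒0<q-p α<1
  lower-gap : ∀ α e D → α * e - D ≡ e - D - (1ℚ - α) * e
  lower-gap = solve-∀ ringℚ
  upper-gap : ∀ α e D → 1ℚ * e - (1ℚ - α) * (e - D) ≡ α * α * e + (1ℚ - α) * (α * e + D)
  upper-gap = solve-∀ ringℚ
  distrib : ∀ a r e D → a * r * e - a * (e - D) ≡ a * (r * e - (e - D))
  distrib = solve-∀ ringℚ

laplacian-sandwich : ∀ {d c α r} (rotH : RotMap d c) → 0ℚ ≤ α → α < 1ℚ → (1ℚ - α) * r ≡ 1ℚ →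
  LambdaLe rotH α → (z : Vector d) → sumFin d z ≡ 0ℚ →
  ((1ℚ - α) * normSq z ≤ quad (laplacian rotH) z) × (quad (laplacian rotH) z ≤ r * normSq z)
laplacian-sandwich rotH 0≤α α<1 [1-α]r≡1 λH≤α z Σz≡0 =
  subst (_ ≤_) (sym L-form) (proj₁ bounds) , subst (_≤ _) (sym L-form) (proj₂ bounds)
  where
  L-form = quad-idM-M (transM rotH) z
  spectral = dot-bounded z (transM rotH *V z) 0≤α (λH≤α z Σz≡0)
  bounds = scalar-sandwich 0≤α α<1 [1-α]r≡1 (normSq-nonNeg z) (proj₁ spectral) (proj₂ spectral)

module _ {n d c} (rotG : RotMap n (suc d)) (rotG-involutive : IsRotMap rotG)
         (rotH : RotMap (suc d) (suc c)) (rotH-involutive : IsRotMap rotH) where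

  dsLaplacian-sandwich : ∀ {α r} → 0ℚ ≤ α → α < 1ℚ → (1ℚ - α) * r ≡ 1ℚ → LambdaLe rotH α →
    ∀ x →
    ((1ℚ - α) * quad (laplacianSq rotG) x ≤ quad (dsLaplacian rotG rotH) x) ×
    (quad (dsLaplacian rotG rotH) x ≤ r * quad (laplacianSq rotG) x)
  dsLaplacian-sandwich {α} {r} 0≤α α<1 [1-α]r≡1 λH≤α x =
    subst₂ (λ a b → (1ℚ - α) * a ≤ b) (sym G²-form) (sym GⓈH-form) (proj₁ summed) ,
    subst₂ (λ a b → b ≤ r * a) (sym G²-form) (sym GⓈH-form) (proj₂ summed)
    where
    z = center ∘ localView rotG x
    G²-form = quad-laplacianSq rotG rotG-involutive x
    GⓈH-form = quad-dsLaplacian rotG rotG-involutive rotH rotH-involutive x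
    summed = sumFin-sandwich n {1ℚ - α} {r} (normSq ∘ z) (quad (laplacian rotH) ∘ z) (invℕ-nonNeg (suc d)) (λ u →
      laplacian-sandwich rotH 0≤α α<1 [1-α]r≡1 λH≤α (z u) (sumFin-center d (localView rotG x u)))

degree-zero-not-aperiodic : ∀ {n} (rot : RotMap (suc n) 0) → ¬ Aperiodic rot
degree-zero-not-aperiodic rot aperiodic with aperiodic Fin.zero
... | () ∷ _ , _

theorem5p7 : (n d c : ℕ) → ℕ._<_ 0 c →
    (rotG : RotMap n d) → IsRotMap rotG → Aperiodic rotG →
    (rotH : RotMap d c) → IsRotMap rotH →
    (α : ℚ) → 0ℚ ≤ α → α < 1ℚ → LambdaLe rotH α →
    Approx (recip (1ℚ - α)) (laplacianSq rotG) (dsLaplacian rotG rotH)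
-- Without vertices both quadratic forms are the empty sum.
theorem5p7 zero    zero    _       _  _    _ _ _    _ _ _ _ _ = (λ _ → ≤-refl) , (λ _ → ≤-refl)
theorem5p7 (suc n) zero    _       _  rotG _ aperiodic _ _ _ _ _ _ = ⊥-elim (degree-zero-not-aperiodic rotG aperiodic)
theorem5p7 n       (suc d) (suc c) _  rotG rotG-inv _ rotH rotH-inv α 0≤α α<1 λH≤α =
  (λ x → subst (_≤ _) (sym (scaled-by-recip-r x)) (proj₁ (bounds x))) ,
  (λ x → subst (_ ≤_) (sym (quad-·M r (laplacianSq rotG) x)) (proj₂ (bounds x)))
  where
  1-α≢0 : 1ℚ - α ≢ 0ℚ
  1-α≢0 = ≢-sym (<⇒≢ (p<q⇒0<q-p α<1))
  r = recip (1ℚ - α)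
  bounds = dsLaplacian-sandwich rotG rotG-inv rotH rotH-inv 0≤α α<1 (recip-inverse 1-α≢0) λH≤α
  scaled-by-recip-r : ∀ x → quad (recip r ·M laplacianSq rotG) x ≡ (1ℚ - α) * quad (laplacianSq rotG) x
  scaled-by-recip-r x =
    trans (quad-·M (recip r) (laplacianSq rotG) x) (cong (_* quad (laplacianSq rotG) x) (recip-involutive 1-α≢0))
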